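{- Let $M$ be a $3$-connected matroid and let $C^*$ be a $4$-element cocircuit of $M$. If there are distinct elements $c',c''\in C^*$ such that neither $c'$ nor $c''$ is in a triangle, then $M/c$ is $3$-connected for some $c\in C^*$. -}

module Defs where

open import Data.Nat using (ℕ; _+_; _∸_; _≤_; _<_)
open import Data.Fin using (Fin)
open import Data.Fin.Subset using (Subset; _∪_; _∩_; _⊆_; _⊂_; _∈_; _─_; _-_; ∣_∣; ⁅_⁆; ∁; ⊤)
open import Data.Product using (_×_; ∃)
open import Relation.Nullary using (¬_)
open import Relation.Binary.PropositionalEquality using (_≡_)

record Matroid (n : ℕ) : Set where
  field
    rank : Subset n → ℕ
    R1 : ∀ X → rank X ≤ ∣ X ∣
    R2 : ∀ {X Y} → X ⊆ Y → rank X ≤ rank Y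
    R3 : ∀ X Y → rank (X ∪ Y) + rank (X ∩ Y) ≤ rank X + rank Y

open Matroid public

-- Generic notions relative to a ground set G ⊆ Fin n and a rank function ρ
-- (so that minors can be described without re-indexing the ground set).

Dependent : ∀ {n} → (Subset n → ℕ) → Subset n → Set
Dependent ρ X = ρ X < ∣ X ∣

IsCircuit : ∀ {n} → (Subset n → ℕ) → Subset n → Set
IsCircuit ρ C = Dependent ρ C × (∀ Y → Y ⊂ C → ¬ Dependent ρ Y)

dualRank : ∀ {n} → Matroid n → Subset n → ℕ
dualRank M X = (∣ X ∣ + rank M (∁ X)) ∸ rank M ⊤

IsCocircuit : ∀ {n} → Matroid n → Subset n → Set
IsCocircuit M C = IsCircuit (dualRank M) C

IsTriangle : ∀ {n} → Matroid n → Subset n → Set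
IsTriangle M T = IsCircuit (rank M) T × ∣ T ∣ ≡ 3

InTriangle : ∀ {n} → Matroid n → Fin n → Set
InTriangle M e = ∃ λ T → IsTriangle M T × e ∈ T

IsSeparation : ∀ {n} → Subset n → (Subset n → ℕ) → ℕ → Subset n → Set
IsSeparation G ρ k X =
  X ⊆ G × k ≤ ∣ X ∣ × k ≤ ∣ G ─ X ∣ × ρ X + ρ (G ─ X) < ρ G + k

Connected : ∀ {n} → ℕ → Subset n → (Subset n → ℕ) → Set
Connected N G ρ = ∀ k → 1 ≤ k → k < N → ∀ X → ¬ IsSeparation G ρ k X

IsNConnected : ∀ {n} → ℕ → Matroid n → Set
IsNConnected N M = Connected N ⊤ (rank M)

contractRank : ∀ {n} → Matroid n → Fin n → Subset n → ℕ
contractRank M c X = rank M (X ∪ ⁅ c ⁆) ∸ rank M ⁅ c ⁆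

ContractionIsNConnected : ∀ {n} → ℕ → Matroid n → Fin n → Set
ContractionIsNConnected N M c = Connected N (⊤ - c) (contractRank M c)

module Submission where

-- If M / c′ is not 3-connected it has a 2-separation, that is, a vertical
-- 3-separation (X, c′, Y) of M.  Since c′ ∈ cl X ∩ cl Y and C is a cocircuit, both sides meet
-- C − c′, so one side, say Y, meets C in a single element y; then Y − y avoids C and
-- r(Y − y) < r(Y), so y ∉ cl X.  Uncross a vertical 3-separation (P, y, Q) of M with c′ ∈ P
-- against (X, c′, Y).  If Q ∩ X = {q}, then Q meets C only in q, so by the same argument
-- r(X − q) < r(X), contradicting q ∈ cl Y.  Otherwise submodularity forces P ⊆ X ∪ c′, hence
-- y ∈ cl X, unless it produces a triangle through c′.  So M / y is 3-connected unless y lies in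
-- a triangle.  That triangle meets C again in some z ∈ X; moving z into Y leaves X − z meeting C
-- only in c″, and the same argument shows that M / c″ is 3-connected.

open import Defs
open import Data.Nat using (ℕ; zero; suc; _+_; _∸_; _≤_; _<_; z≤n; s≤s; _≤?_; _<?_)
open import Data.Nat.Properties
open import Data.Fin using (Fin) renaming (_≟_ to _≟F_)
open import Data.Fin.Properties using (any?)
open import Data.Fin.Subset using (Subset; _∈_; _∉_; ∣_∣; _∪_; _∩_; ∁; ⊤; ⁅_⁆; _─_; _-_; _⊆_; _⊂_; inside; outside)
open import Data.Fin.Subset.Properties
open import Data.Vec.Base using (_∷_; []; there)
open import Data.Product using (_×_; ∃; ∃₂; _,_; proj₁; proj₂)
open import Data.Sum using (_⊎_; inj₁; inj₂) renaming (swap to ⊎-swap)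
open import Data.Empty using (⊥; ⊥-elim)
open import Function using (_∘_)
open import Relation.Binary.PropositionalEquality using (_≡_; _≢_; refl; sym; trans; cong; subst; ≢-sym)
open import Relation.Nullary using (¬_; Dec; yes; no; ¬?; _×-dec_)
open import Relation.Nullary.Decidable using (decidable-stable)
open import Algebra.Properties.CommutativeSemigroup +-commutativeSemigroup using (interchange)

∣p∪q∣≤∣p∣+∣q∣ : ∀ {m} (p q : Subset m) → ∣ p ∪ q ∣ ≤ ∣ p ∣ + ∣ q ∣
∣p∪q∣≤∣p∣+∣q∣ []            []            = z≤n
∣p∪q∣≤∣p∣+∣q∣ (outside ∷ p) (outside ∷ q) = ∣p∪q∣≤∣p∣+∣q∣ p q
∣p∪q∣≤∣p∣+∣q∣ (outside ∷ p) (inside  ∷ q) rewrite +-suc ∣ p ∣ ∣ q ∣ = s≤s (∣p∪q∣≤∣p∣+∣q∣ p q)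
∣p∪q∣≤∣p∣+∣q∣ (inside  ∷ p) (outside ∷ q) = s≤s (∣p∪q∣≤∣p∣+∣q∣ p q)
∣p∪q∣≤∣p∣+∣q∣ (inside  ∷ p) (inside  ∷ q) =
  s≤s (≤-trans (∣p∪q∣≤∣p∣+∣q∣ p q) (+-monoʳ-≤ ∣ p ∣ (n≤1+n ∣ q ∣)))

∣p∪⁅x⁆∣≤1+∣p∣ : ∀ {m} (p : Subset m) (x : Fin m) → ∣ p ∪ ⁅ x ⁆ ∣ ≤ suc ∣ p ∣
∣p∪⁅x⁆∣≤1+∣p∣ p x = ≤-trans (∣p∪q∣≤∣p∣+∣q∣ p ⁅ x ⁆)
  (≤-reflexive (trans (cong (∣ p ∣ +_) (∣⁅x⁆∣≡1 x)) (+-comm ∣ p ∣ 1)))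

x∉p⇒∣p∣<∣p∪⁅x⁆∣ : ∀ {m} {x : Fin m} (p : Subset m) → x ∉ p → ∣ p ∣ < ∣ p ∪ ⁅ x ⁆ ∣
x∉p⇒∣p∣<∣p∪⁅x⁆∣ {x = x} p x∉p = p⊂q⇒∣p∣<∣q∣ (p⊆p∪q ⁅ x ⁆ , x , q⊆p∪q p ⁅ x ⁆ (x∈⁅x⁆ x) , x∉p)

x∉p⇒∣p∪⁅x⁆∣≡1+∣p∣ : ∀ {m} {x : Fin m} (p : Subset m) → x ∉ p → ∣ p ∪ ⁅ x ⁆ ∣ ≡ suc ∣ p ∣
x∉p⇒∣p∪⁅x⁆∣≡1+∣p∣ {x = x} p x∉p = ≤-antisym (∣p∪⁅x⁆∣≤1+∣p∣ p x) (x∉p⇒∣p∣<∣p∪⁅x⁆∣ p x∉p)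

x∈p─q⇒x∉q : ∀ {m} {x : Fin m} (p q : Subset m) → x ∈ p ─ q → x ∉ q
x∈p─q⇒x∉q {x = Fin.zero}  (_ ∷ p) (inside  ∷ q) ()
x∈p─q⇒x∉q {x = Fin.zero}  (_ ∷ p) (outside ∷ q) _ ()
x∈p─q⇒x∉q {x = Fin.suc x} (_ ∷ p) (_ ∷ q) (there x∈p─q) (there x∈q) = x∈p─q⇒x∉q p q x∈p─q x∈q

x∈p∧y∉p⇒x≢y : ∀ {m} {x y : Fin m} {p : Subset m} → x ∈ p → y ∉ p → x ≢ y
x∈p∧y∉p⇒x≢y x∈p y∉p refl = y∉p x∈p

x≡y⇒x∈⁅y⁆ : ∀ {m} {x y : Fin m} → x ≡ y → x ∈ ⁅ y ⁆
x≡y⇒x∈⁅y⁆ refl = x∈⁅x⁆ _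

x∉p∪q : ∀ {m} {x : Fin m} {p q : Subset m} → x ∉ p → x ∉ q → x ∉ p ∪ q
x∉p∪q {p = p} {q} x∉p x∉q x∈p∪q with x∈p∪q⁻ p q x∈p∪q
... | inj₁ x∈p = x∉p x∈p
... | inj₂ x∈q = x∉q x∈q

∪-least : ∀ {m} {p q s : Subset m} → p ⊆ s → q ⊆ s → p ∪ q ⊆ s
∪-least {p = p} {q} p⊆s q⊆s x∈p∪q with x∈p∪q⁻ p q x∈p∪q
... | inj₁ x∈p = p⊆s x∈p
... | inj₂ x∈q = q⊆s x∈q

x∈p⇒⁅x⁆⊆p : ∀ {m} {x : Fin m} {p : Subset m} → x ∈ p → ⁅ x ⁆ ⊆ p
x∈p⇒⁅x⁆⊆p {x = x} {p} x∈p y∈⁅x⁆ = subst (_∈ p) (sym (x∈⁅y⁆⇒x≡y _ y∈⁅x⁆)) x∈p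

p⊆[p-x]∪⁅x⁆ : ∀ {m} (p : Subset m) (x : Fin m) → p ⊆ (p - x) ∪ ⁅ x ⁆
p⊆[p-x]∪⁅x⁆ p x {y} y∈p with y ≟F x
... | yes refl = q⊆p∪q (p - x) ⁅ x ⁆ (x∈⁅x⁆ x)
... | no y≢x   = p⊆p∪q ⁅ x ⁆ (x∈p∧x≢y⇒x∈p-y y∈p y≢x)

∣p∣≤1+∣p-x∣ : ∀ {m} (p : Subset m) (x : Fin m) → ∣ p ∣ ≤ suc ∣ p - x ∣
∣p∣≤1+∣p-x∣ p x = ≤-trans (p⊆q⇒∣p∣≤∣q∣ (p⊆[p-x]∪⁅x⁆ p x)) (∣p∪⁅x⁆∣≤1+∣p∣ (p - x) x)

∁[p-x]⊆∁p∪⁅x⁆ : ∀ {m} (p : Subset m) (x : Fin m) → ∁ (p - x) ⊆ ∁ p ∪ ⁅ x ⁆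
∁[p-x]⊆∁p∪⁅x⁆ p x {y} y∈∁[p-x] with y ≟F x
... | yes refl = q⊆p∪q (∁ p) ⁅ x ⁆ (x∈⁅x⁆ x)
... | no y≢x   = p⊆p∪q ⁅ x ⁆ (x∉p⇒x∈∁p λ y∈p → x∈∁p⇒x∉p y∈∁[p-x] (x∈p∧x≢y⇒x∈p-y y∈p y≢x))

∣∁p∣+∣p∣≡m : ∀ {m} (p : Subset m) → ∣ ∁ p ∣ + ∣ p ∣ ≡ m
∣∁p∣+∣p∣≡m p = trans (cong (_+ ∣ p ∣) (∣∁p∣≡n∸∣p∣ p)) (m∸n+n≡m (∣p∣≤n p))

1≤∣p∣ : ∀ {m} {p : Subset m} {a} → a ∈ p → 1 ≤ ∣ p ∣
1≤∣p∣ {a = a} a∈p = subst (_≤ _) (∣⁅x⁆∣≡1 a) (p⊆q⇒∣p∣≤∣q∣ (x∈p⇒⁅x⁆⊆p a∈p))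

2≤∣p∣ : ∀ {m} {p : Subset m} {a b} → a ≢ b → a ∈ p → b ∈ p → 2 ≤ ∣ p ∣
2≤∣p∣ a≢b a∈p b∈p = ≤-trans (s≤s (1≤∣p∣ (x∈p∧x≢y⇒x∈p-y a∈p a≢b))) (x∈p⇒∣p-x∣<∣p∣ b∈p)

3≤∣p∣ : ∀ {m} {p : Subset m} {a b c} → a ≢ b → c ≢ a → c ≢ b → a ∈ p → b ∈ p → c ∈ p → 3 ≤ ∣ p ∣
3≤∣p∣ a≢b c≢a c≢b a∈p b∈p c∈p = ≤-trans
  (s≤s (2≤∣p∣ a≢b (x∈p∧x≢y⇒x∈p-y a∈p (≢-sym c≢a)) (x∈p∧x≢y⇒x∈p-y b∈p (≢-sym c≢b))))
  (x∈p⇒∣p-x∣<∣p∣ c∈p)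

4≤∣p∣ : ∀ {m} {p : Subset m} {a b c d} → a ≢ b → c ≢ a → c ≢ b → d ≢ a → d ≢ b → d ≢ c →
        a ∈ p → b ∈ p → c ∈ p → d ∈ p → 4 ≤ ∣ p ∣
4≤∣p∣ a≢b c≢a c≢b d≢a d≢b d≢c a∈p b∈p c∈p d∈p = ≤-trans
  (s≤s (3≤∣p∣ a≢b c≢a c≢b (x∈p∧x≢y⇒x∈p-y a∈p (≢-sym d≢a))
    (x∈p∧x≢y⇒x∈p-y b∈p (≢-sym d≢b)) (x∈p∧x≢y⇒x∈p-y c∈p (≢-sym d≢c))))
  (x∈p⇒∣p-x∣<∣p∣ d∈p)

5≤∣p∣ : ∀ {m} {p : Subset m} {a b c d z} → a ≢ b → c ≢ a → c ≢ b → d ≢ a → d ≢ b → d ≢ c →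
        z ≢ a → z ≢ b → z ≢ c → z ≢ d → a ∈ p → b ∈ p → c ∈ p → d ∈ p → z ∈ p → 5 ≤ ∣ p ∣
5≤∣p∣ a≢b c≢a c≢b d≢a d≢b d≢c z≢a z≢b z≢c z≢d a∈p b∈p c∈p d∈p z∈p = ≤-trans
  (s≤s (4≤∣p∣ a≢b c≢a c≢b d≢a d≢b d≢c (x∈p∧x≢y⇒x∈p-y a∈p (≢-sym z≢a))
    (x∈p∧x≢y⇒x∈p-y b∈p (≢-sym z≢b)) (x∈p∧x≢y⇒x∈p-y c∈p (≢-sym z≢c)) (x∈p∧x≢y⇒x∈p-y d∈p (≢-sym z≢d))))
  (x∈p⇒∣p-x∣<∣p∣ z∈p)

triple : ∀ {m} → Fin m → Fin m → Fin m → Subset m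
triple a b c = (⁅ a ⁆ ∪ ⁅ b ⁆) ∪ ⁅ c ⁆

∣triple∣≡3 : ∀ {m} {a b c : Fin m} → a ≢ b → c ≢ a → c ≢ b → ∣ triple a b c ∣ ≡ 3
∣triple∣≡3 {a = a} {b} {c} a≢b c≢a c≢b = ≤-antisym
  (≤-trans (∣p∪⁅x⁆∣≤1+∣p∣ (⁅ a ⁆ ∪ ⁅ b ⁆) c)
           (s≤s (≤-trans (∣p∪⁅x⁆∣≤1+∣p∣ ⁅ a ⁆ b) (s≤s (≤-reflexive (∣⁅x⁆∣≡1 a))))))
  (3≤∣p∣ a≢b c≢a c≢b a∈ b∈ c∈)
  where
  a∈ : a ∈ triple a b c
  a∈ = p⊆p∪q ⁅ c ⁆ (p⊆p∪q ⁅ b ⁆ (x∈⁅x⁆ a))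
  b∈ : b ∈ triple a b c
  b∈ = p⊆p∪q ⁅ c ⁆ (q⊆p∪q ⁅ a ⁆ ⁅ b ⁆ (x∈⁅x⁆ b))
  c∈ : c ∈ triple a b c
  c∈ = q⊆p∪q (⁅ a ⁆ ∪ ⁅ b ⁆) ⁅ c ⁆ (x∈⁅x⁆ c)

triple⊆ : ∀ {m} {a b c : Fin m} {p : Subset m} → a ∈ p → b ∈ p → c ∈ p → triple a b c ⊆ p
triple⊆ a∈p b∈p c∈p = ∪-least (∪-least (x∈p⇒⁅x⁆⊆p a∈p) (x∈p⇒⁅x⁆⊆p b∈p)) (x∈p⇒⁅x⁆⊆p c∈p)

infix 4 _∩_≡⁅_⁆
_∩_≡⁅_⁆ : ∀ {m} → Subset m → Subset m → Fin m → Set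
A ∩ S ≡⁅ a ⁆ = a ∈ A × a ∈ S × (∀ {x} → x ∈ A → x ∈ S → x ≡ a)

∩≡⁅⁆-or-another : ∀ {m} {A S : Subset m} {a} → a ∈ A → a ∈ S →
                  A ∩ S ≡⁅ a ⁆ ⊎ ∃ λ a′ → a′ ∈ A × a′ ∈ S × a′ ≢ a
∩≡⁅⁆-or-another {A = A} {S} {a} a∈A a∈S with any? (λ x → x ∈? A ×-dec x ∈? S ×-dec ¬? (x ≟F a))
... | yes another = inj₂ another
... | no none     = inj₁ (a∈A , a∈S , λ {x} x∈A x∈S →
  decidable-stable (x ≟F a) λ x≢a → none (x , x∈A , x∈S , x≢a))

∩≡⁅a⁆⇒A-a⊆∁S : ∀ {m} {A S : Subset m} {a} → A ∩ S ≡⁅ a ⁆ → A - a ⊆ ∁ S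
∩≡⁅a⁆⇒A-a⊆∁S {A = A} {a = a} (_ , _ , only-a) x∈A-a = x∉p⇒x∈∁p λ x∈S →
  x∈p─q⇒x∉q A ⁅ a ⁆ x∈A-a (x≡y⇒x∈⁅y⁆ (only-a (p─q⊆p A ⁅ a ⁆ x∈A-a) x∈S))

∉p-y⇒∈q∪⁅y⁆ : ∀ {m} {p q : Subset m} {y} → (∀ {x} → x ∉ p → x ∈ q) → ∀ {x} → x ∉ p - y → x ∈ q ∪ ⁅ y ⁆
∉p-y⇒∈q∪⁅y⁆ {p = p} {q} {y} ∁p⊆q {x} x∉p-y with x ≟F y
... | yes refl = q⊆p∪q q ⁅ x ⁆ (x∈⁅x⁆ x)
... | no x≢y   = p⊆p∪q ⁅ y ⁆ (∁p⊆q λ x∈p → x∉p-y (x∈p∧x≢y⇒x∈p-y x∈p x≢y))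

pred-sum<⇒sum≤ : ∀ {a b g k} → 1 ≤ a → 1 ≤ b → 1 ≤ g → (a ∸ 1) + (b ∸ 1) < (g ∸ 1) + k → a + b ≤ g + k
pred-sum<⇒sum≤ {suc a} {suc b} {suc g} _ _ _ lt rewrite +-suc a b = s≤s lt

separation? : ∀ {m} G (ρ : Subset m → ℕ) k X → Dec (IsSeparation G ρ k X)
separation? G ρ k X =
  (X ⊆? G) ×-dec (k ≤? ∣ X ∣) ×-dec (k ≤? ∣ G ─ X ∣) ×-dec (ρ X + ρ (G ─ X) <? ρ G + k)

module Rank {n : ℕ} (M : Matroid n) where

  r : Subset n → ℕ
  r = rank M

  R : ℕ
  R = r ⊤

  r-mono : ∀ {A B} → A ⊆ B → r A ≤ r B
  r-mono = R2 M

  r-submodular : ∀ A B {U I} → U ⊆ A ∪ B → I ⊆ A ∩ B → r U + r I ≤ r A + r B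
  r-submodular A B U⊆A∪B I⊆A∩B = ≤-trans (+-mono-≤ (r-mono U⊆A∪B) (r-mono I⊆A∩B)) (R3 M A B)

  r⁅x⁆≤1 : ∀ x → r ⁅ x ⁆ ≤ 1
  r⁅x⁆≤1 x = ≤-trans (R1 M ⁅ x ⁆) (≤-reflexive (∣⁅x⁆∣≡1 x))

  r[Z∪x]≤1+r[Z] : ∀ Z x → r (Z ∪ ⁅ x ⁆) ≤ suc (r Z)
  r[Z∪x]≤1+r[Z] Z x = begin
    r (Z ∪ ⁅ x ⁆)                  ≤⟨ m≤m+n _ _ ⟩
    r (Z ∪ ⁅ x ⁆) + r (Z ∩ ⁅ x ⁆)  ≤⟨ R3 M Z ⁅ x ⁆ ⟩
    r Z + r ⁅ x ⁆                  ≤⟨ +-monoʳ-≤ (r Z) (r⁅x⁆≤1 x) ⟩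
    r Z + 1                        ≡⟨ +-comm (r Z) 1 ⟩
    suc (r Z)                      ∎
    where open ≤-Reasoning

  codependent⇒r[∁X]<R : ∀ X → Dependent (dualRank M) X → r (∁ X) < R
  codependent⇒r[∁X]<R X r*X<∣X∣ = ≰⇒> λ R≤r∁X → <⇒≱ r*X<∣X∣ (begin
    ∣ X ∣                    ≤⟨ m≤m+n ∣ X ∣ _ ⟩
    ∣ X ∣ + (r (∁ X) ∸ R)    ≡⟨ sym (+-∸-assoc ∣ X ∣ R≤r∁X) ⟩
    dualRank M X             ∎)
    where open ≤-Reasoning

  -- Nonemptiness of X stops the truncated subtraction in dualRank from hiding r (∁ X) < R.
  coindependent⇒R≤r[∁X] : ∀ X → 1 ≤ ∣ X ∣ → ¬ Dependent (dualRank M) X → R ≤ r (∁ X)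
  coindependent⇒R≤r[∁X] X 1≤∣X∣ r*X≮∣X∣ = ≮⇒≥ λ r∁X<R → r*X≮∣X∣ (codependent r∁X<R)
    where
    codependent : r (∁ X) < R → dualRank M X < ∣ X ∣
    codependent r∁X<R with ≤-total R (∣ X ∣ + r (∁ X))
    ... | inj₂ sum≤R rewrite m≤n⇒m∸n≡0 sum≤R = 1≤∣X∣
    ... | inj₁ R≤sum = +-cancelʳ-< R (dualRank M X) ∣ X ∣
      (subst (_< ∣ X ∣ + R) (sym (m∸n+n≡m R≤sum)) (+-monoʳ-< ∣ X ∣ r∁X<R))

  infix 4 _∈cl_
  _∈cl_ : Fin n → Subset n → Set
  x ∈cl Z = r (Z ∪ ⁅ x ⁆) ≤ r Z

  ∈cl-mono : ∀ {x P Z} → P ⊆ Z → x ∈cl P → x ∈cl Z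
  ∈cl-mono {x} {P} {Z} P⊆Z x∈clP = +-cancelʳ-≤ (r P) _ _ (begin
    r (Z ∪ ⁅ x ⁆) + r P  ≤⟨ r-submodular (P ∪ ⁅ x ⁆) Z Z∪x⊆ P⊆ ⟩
    r (P ∪ ⁅ x ⁆) + r Z  ≤⟨ +-monoˡ-≤ (r Z) x∈clP ⟩
    r P + r Z            ≡⟨ +-comm (r P) (r Z) ⟩
    r Z + r P            ∎)
    where
    open ≤-Reasoning
    Z∪x⊆ : Z ∪ ⁅ x ⁆ ⊆ (P ∪ ⁅ x ⁆) ∪ Z
    Z∪x⊆ = ∪-least (q⊆p∪q (P ∪ ⁅ x ⁆) Z) (⊆-trans (q⊆p∪q P ⁅ x ⁆) (p⊆p∪q Z))
    P⊆ : P ⊆ (P ∪ ⁅ x ⁆) ∩ Z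
    P⊆ x∈P = x∈p∩q⁺ (p⊆p∪q ⁅ x ⁆ x∈P , P⊆Z x∈P)

  r[Z∪a∪b]≤r[Z] : ∀ {a b Z} → a ∈cl Z → b ∈cl Z → r ((Z ∪ ⁅ a ⁆) ∪ ⁅ b ⁆) ≤ r Z
  r[Z∪a∪b]≤r[Z] a∈clZ b∈clZ = ≤-trans (∈cl-mono (p⊆p∪q _) b∈clZ) a∈clZ

  ∈cl-trans : ∀ {e y X} → e ∈cl X → y ∈cl (X ∪ ⁅ e ⁆) → y ∈cl X
  ∈cl-trans {e} {y} {X} e∈clX y∈cl[X∪e] =
    ≤-trans (r-mono X∪y⊆) (≤-trans y∈cl[X∪e] e∈clX)
    where
    X∪y⊆ : X ∪ ⁅ y ⁆ ⊆ (X ∪ ⁅ e ⁆) ∪ ⁅ y ⁆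
    X∪y⊆ = ∪-least (⊆-trans (p⊆p∪q ⁅ e ⁆) (p⊆p∪q ⁅ y ⁆)) (q⊆p∪q _ ⁅ y ⁆)

  circuit⇒∈cl : ∀ {T x} → IsCircuit r T → x ∈ T → x ∈cl (T - x)
  circuit⇒∈cl {T} {x} (rT<∣T∣ , minimal) x∈T = begin
    r ((T - x) ∪ ⁅ x ⁆)  ≤⟨ r-mono (∪-least (p─q⊆p T ⁅ x ⁆) (x∈p⇒⁅x⁆⊆p x∈T)) ⟩
    r T                  ≤⟨ ≤-pred (≤-trans rT<∣T∣ (∣p∣≤1+∣p-x∣ T x)) ⟩
    ∣ T - x ∣            ≤⟨ ≮⇒≥ (minimal (T - x) (x∈p⇒p-x⊂p x∈T)) ⟩
    r (T - x)            ∎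
    where open ≤-Reasoning

module ThreeConnected {n : ℕ} (M : Matroid n) (3-connected : IsNConnected 3 M) (4≤n : 4 ≤ n) where

  open Rank M

  R+k≤r[A]+r[B] : ∀ k → 1 ≤ k → k < 3 → ∀ A B → (∀ {x} → x ∉ A → x ∈ B) →
                  k ≤ ∣ A ∣ → k ≤ ∣ ∁ A ∣ → R + k ≤ r A + r B
  R+k≤r[A]+r[B] k 1≤k k<3 A B ∁A⊆B k≤∣A∣ k≤∣∁A∣ =
    ≤-trans (≮⇒≥ λ sum<R+k → 3-connected k 1≤k k<3 A (⊆⊤ , k≤∣A∣ , k≤∣⊤─A∣ , sum<R+k))
            (+-monoʳ-≤ (r A) (r-mono (λ x∈⊤─A → ∁A⊆B (x∈p─q⇒x∉q ⊤ A x∈⊤─A))))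
    where
    ∁A⊆⊤─A : ∁ A ⊆ ⊤ ─ A
    ∁A⊆⊤─A x∈∁A = x∈p∧x∉q⇒x∈p─q ∈⊤ (x∈∁p⇒x∉p x∈∁A)
    k≤∣⊤─A∣ : k ≤ ∣ ⊤ ─ A ∣
    k≤∣⊤─A∣ = ≤-trans k≤∣∁A∣ (p⊆q⇒∣p∣≤∣q∣ ∁A⊆⊤─A)

  no-1-separation : ∀ A B → (∀ {x} → x ∉ A → x ∈ B) → 1 ≤ ∣ A ∣ → 1 ≤ ∣ ∁ A ∣ → R + 1 ≤ r A + r B
  no-1-separation = R+k≤r[A]+r[B] 1 (s≤s z≤n) (s≤s (s≤s z≤n))

  no-2-separation : ∀ A B → (∀ {x} → x ∉ A → x ∈ B) → 2 ≤ ∣ A ∣ → 2 ≤ ∣ ∁ A ∣ → R + 2 ≤ r A + r B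
  no-2-separation = R+k≤r[A]+r[B] 2 (s≤s z≤n) (s≤s (s≤s (s≤s z≤n)))

  ∣A∣≤2⇒2≤∣∁A∣ : ∀ A → ∣ A ∣ ≤ 2 → 2 ≤ ∣ ∁ A ∣
  ∣A∣≤2⇒2≤∣∁A∣ A ∣A∣≤2 = +-cancelʳ-≤ (∣ A ∣) 2 (∣ ∁ A ∣)
    (≤-trans (+-monoʳ-≤ 2 ∣A∣≤2) (≤-trans 4≤n (≤-reflexive (sym (∣∁p∣+∣p∣≡m A)))))

  ∣A∣≤2⇒∣A∣≤r[A] : ∀ A → ∣ A ∣ ≤ 2 → ∣ A ∣ ≤ r A
  ∣A∣≤2⇒∣A∣≤r[A] A ∣A∣≤2 with ∣ A ∣ in ∣A∣≡
  ... | zero  = z≤n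
  ... | suc k = +-cancelˡ-≤ R (suc k) (r A) (begin
    R + suc k  ≤⟨ R+k≤r[A]+r[B] (suc k) (s≤s z≤n) (s≤s ∣A∣≤2) A ⊤ (λ _ → ∈⊤)
                                 (≤-reflexive (sym ∣A∣≡)) 1+k≤∣∁A∣ ⟩
    r A + R    ≡⟨ +-comm (r A) R ⟩
    R + r A    ∎)
    where
    open ≤-Reasoning
    1+k≤∣∁A∣ : suc k ≤ ∣ ∁ A ∣
    1+k≤∣∁A∣ = ≤-trans ∣A∣≤2 (∣A∣≤2⇒2≤∣∁A∣ A (subst (_≤ 2) (sym ∣A∣≡) ∣A∣≤2))

  r⁅x⁆≡1 : ∀ x → r ⁅ x ⁆ ≡ 1
  r⁅x⁆≡1 x = ≤-antisym (r⁅x⁆≤1 x)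
    (subst (_≤ r ⁅ x ⁆) (∣⁅x⁆∣≡1 x) (∣A∣≤2⇒∣A∣≤r[A] ⁅ x ⁆ (≤-trans (≤-reflexive (∣⁅x⁆∣≡1 x)) (s≤s z≤n))))

  r≤2⇒InTriangle : ∀ {T e} → e ∈ T → ∣ T ∣ ≡ 3 → r T ≤ 2 → InTriangle M e
  r≤2⇒InTriangle {T} e∈T ∣T∣≡3 rT≤2 =
    T , ((subst (r T <_) (sym ∣T∣≡3) (s≤s rT≤2) , proper-subsets-independent) , ∣T∣≡3) , e∈T
    where
    proper-subsets-independent : ∀ Y → Y ⊂ T → ¬ Dependent r Y
    proper-subsets-independent Y Y⊂T =
      ≤⇒≯ (∣A∣≤2⇒∣A∣≤r[A] Y (≤-pred (subst (∣ Y ∣ <_) ∣T∣≡3 (p⊂q⇒∣p∣<∣q∣ Y⊂T))))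

  -- (A, B) is a k-separation of M / e, with ranks computed in M.  For k = 2 this says that
  -- (A, {e}, B) is a vertical 3-separation of M.
  record ContractSep (k : ℕ) (e : Fin n) (A B : Subset n) : Set where
    field
      e∉A      : e ∉ A
      e∉B      : e ∉ B
      cover    : ∀ x → x ≢ e → x ∈ A ⊎ x ∈ B
      disjoint : ∀ {x} → x ∈ A → x ∉ B
      k≤∣A∣    : k ≤ ∣ A ∣
      k≤∣B∣    : k ≤ ∣ B ∣
      rank-sum : r (A ∪ ⁅ e ⁆) + r (B ∪ ⁅ e ⁆) ≤ R + k

  swap-sides : ∀ {k e A B} → ContractSep k e A B → ContractSep k e B A
  swap-sides {k} {e} {A} {B} s = record
    { e∉A      = e∉B
    ; e∉B      = e∉A
    ; cover    = λ x x≢e → ⊎-swap (cover x x≢e)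
    ; disjoint = λ x∈B x∈A → disjoint x∈A x∈B
    ; k≤∣A∣    = k≤∣B∣
    ; k≤∣B∣    = k≤∣A∣
    ; rank-sum = subst (_≤ R + k) (+-comm (r (A ∪ ⁅ e ⁆)) (r (B ∪ ⁅ e ⁆))) rank-sum
    }
    where open ContractSep s

  module ContractSepFacts {k e A B} (s : ContractSep k e A B) where
    open ContractSep s

    ∉A⇒∈B∪e : ∀ {x} → x ∉ A → x ∈ B ∪ ⁅ e ⁆
    ∉A⇒∈B∪e {x} x∉A with x ≟F e
    ... | yes refl = q⊆p∪q B ⁅ x ⁆ (x∈⁅x⁆ x)
    ... | no x≢e with cover x x≢e
    ...   | inj₁ x∈A = ⊥-elim (x∉A x∈A)
    ...   | inj₂ x∈B = p⊆p∪q ⁅ e ⁆ x∈B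

    B⊆∁A : B ⊆ ∁ A
    B⊆∁A x∈B = x∉p⇒x∈∁p λ x∈A → disjoint x∈A x∈B

    B∪e⊆∁A : B ∪ ⁅ e ⁆ ⊆ ∁ A
    B∪e⊆∁A = ∪-least B⊆∁A (x∈p⇒⁅x⁆⊆p (x∉p⇒x∈∁p e∉A))

    R+2≤r[A]+r[B∪e] : 2 ≤ ∣ A ∣ → 1 ≤ ∣ B ∣ → R + 2 ≤ r A + r (B ∪ ⁅ e ⁆)
    R+2≤r[A]+r[B∪e] 2≤∣A∣ 1≤∣B∣ = no-2-separation A (B ∪ ⁅ e ⁆) ∉A⇒∈B∪e 2≤∣A∣
      (≤-trans (s≤s 1≤∣B∣) (≤-trans (x∉p⇒∣p∣<∣p∪⁅x⁆∣ B e∉B) (p⊆q⇒∣p∣≤∣q∣ B∪e⊆∁A)))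

  contract-1-sep⇒∣A∣≤1 : ∀ {e A B} → ContractSep 1 e A B → ∣ A ∣ ≤ 1
  contract-1-sep⇒∣A∣≤1 {e} {A} {B} s = ≤-pred (≰⇒> λ 2≤∣A∣ → n≮n 1 (+-cancelˡ-≤ R 2 1 (begin
    R + 2                          ≤⟨ R+2≤r[A]+r[B∪e] 2≤∣A∣ k≤∣B∣ ⟩
    r A + r (B ∪ ⁅ e ⁆)            ≤⟨ +-monoˡ-≤ _ (r-mono (p⊆p∪q ⁅ e ⁆)) ⟩
    r (A ∪ ⁅ e ⁆) + r (B ∪ ⁅ e ⁆)  ≤⟨ rank-sum ⟩
    R + 1                          ∎)))
    where
    open ≤-Reasoning
    open ContractSep s
    open ContractSepFacts s

  no-contract-1-sep : ∀ {e A B} → ¬ ContractSep 1 e A B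
  no-contract-1-sep {e} {A} {B} s = <⇒≱ (s≤s n≤3) 4≤n
    where
    open ≤-Reasoning
    open ContractSepFacts s
    ⊤⊆A∪B∪e : ⊤ ⊆ A ∪ (B ∪ ⁅ e ⁆)
    ⊤⊆A∪B∪e {x} _ with x ∈? A
    ... | yes x∈A = p⊆p∪q _ x∈A
    ... | no x∉A  = q⊆p∪q A _ (∉A⇒∈B∪e x∉A)
    n≤3 : n ≤ 3
    n≤3 = begin
      n                      ≡⟨ sym (∣⊤∣≡n n) ⟩
      ∣ ⊤ {n} ∣              ≤⟨ p⊆q⇒∣p∣≤∣q∣ ⊤⊆A∪B∪e ⟩
      ∣ A ∪ (B ∪ ⁅ e ⁆) ∣    ≤⟨ ∣p∪q∣≤∣p∣+∣q∣ A (B ∪ ⁅ e ⁆) ⟩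
      ∣ A ∣ + ∣ B ∪ ⁅ e ⁆ ∣  ≤⟨ +-mono-≤ (contract-1-sep⇒∣A∣≤1 s)
                                 (≤-trans (∣p∪⁅x⁆∣≤1+∣p∣ B e) (s≤s (contract-1-sep⇒∣A∣≤1 (swap-sides s)))) ⟩
      3                      ∎

  -- Since c is not a loop, contractRank M c Z = r (Z ∪ ⁅ c ⁆) ∸ 1.
  separation⇒ContractSep : ∀ {c k X} → IsSeparation (⊤ - c) (contractRank M c) k X →
                           ContractSep k c X ((⊤ - c) ─ X)
  separation⇒ContractSep {c} {k} {X} (X⊆⊤-c , k≤∣X∣ , k≤∣Y∣ , ρ-sum<) = record
    { e∉A      = λ c∈X → c∉⊤-c (X⊆⊤-c c∈X)
    ; e∉B      = λ c∈Y → c∉⊤-c (p─q⊆p (⊤ - c) X c∈Y)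
    ; cover    = cover
    ; disjoint = λ x∈X x∈Y → x∈p─q⇒x∉q (⊤ - c) X x∈Y x∈X
    ; k≤∣A∣    = k≤∣X∣
    ; k≤∣B∣    = k≤∣Y∣
    ; rank-sum = subst (λ g → r (X ∪ ⁅ c ⁆) + r (Y ∪ ⁅ c ⁆) ≤ g + k) r[⊤-c∪c]≡R
        (pred-sum<⇒sum≤ (1≤r[Z∪c] X) (1≤r[Z∪c] Y) (1≤r[Z∪c] (⊤ - c))
          (subst (λ s → (r (X ∪ ⁅ c ⁆) ∸ s) + (r (Y ∪ ⁅ c ⁆) ∸ s) < (r ((⊤ - c) ∪ ⁅ c ⁆) ∸ s) + k)
                 (r⁅x⁆≡1 c) ρ-sum<))
    }
    where
    Y : Subset n
    Y = (⊤ - c) ─ X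
    c∉⊤-c : c ∉ ⊤ - c
    c∉⊤-c c∈⊤-c = x∈p─q⇒x∉q ⊤ ⁅ c ⁆ c∈⊤-c (x∈⁅x⁆ c)
    cover : ∀ x → x ≢ c → x ∈ X ⊎ x ∈ Y
    cover x x≢c with x ∈? X
    ... | yes x∈X = inj₁ x∈X
    ... | no x∉X  = inj₂ (x∈p∧x∉q⇒x∈p─q (x∈p∧x≢y⇒x∈p-y ∈⊤ x≢c) x∉X)
    1≤r[Z∪c] : ∀ Z → 1 ≤ r (Z ∪ ⁅ c ⁆)
    1≤r[Z∪c] Z = ≤-trans (≤-reflexive (sym (r⁅x⁆≡1 c))) (r-mono (q⊆p∪q Z ⁅ c ⁆))
    r[⊤-c∪c]≡R : r ((⊤ - c) ∪ ⁅ c ⁆) ≡ R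
    r[⊤-c∪c]≡R = ≤-antisym (r-mono ⊆⊤) (r-mono (λ _ → p⊆[p-x]∪⁅x⁆ ⊤ c ∈⊤))

  contraction-3-connected-or-vertical-sep : ∀ c → ContractionIsNConnected 3 M c ⊎ ∃₂ (ContractSep 2 c)
  contraction-3-connected-or-vertical-sep c with anySubset? (separation? (⊤ - c) (contractRank M c) 2)
  ... | yes (X , sep) = inj₂ (X , _ , separation⇒ContractSep sep)
  ... | no no-2-sep   = inj₁ connected
    where
    connected : ContractionIsNConnected 3 M c
    connected 1 _ _ X sep = no-contract-1-sep (separation⇒ContractSep sep)
    connected 2 _ _ X sep = no-2-sep (X , sep)
    connected (suc (suc (suc _))) _ (s≤s (s≤s (s≤s ())))

  module VerticalSepFacts {e A B} (s : ContractSep 2 e A B) where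
    open ContractSep s
    open ContractSepFacts s

    e∈cl[A] : e ∈cl A
    e∈cl[A] = +-cancelʳ-≤ (r (B ∪ ⁅ e ⁆)) _ _
      (≤-trans rank-sum (R+2≤r[A]+r[B∪e] k≤∣A∣ (≤-trans (s≤s z≤n) k≤∣B∣)))

    r[A]+r[B]≤R+2 : r A + r B ≤ R + 2
    r[A]+r[B]≤R+2 = ≤-trans (+-mono-≤ (r-mono (p⊆p∪q ⁅ e ⁆)) (r-mono (p⊆p∪q ⁅ e ⁆))) rank-sum

    3≤∣A∣ : ¬ InTriangle M e → 3 ≤ ∣ A ∣
    3≤∣A∣ e∉Δ with 3 ≤? ∣ A ∣
    ... | yes 3≤∣A∣ = 3≤∣A∣
    ... | no 3≰∣A∣  = ⊥-elim (e∉Δ (r≤2⇒InTriangle (q⊆p∪q A ⁅ e ⁆ (x∈⁅x⁆ e)) ∣A∪e∣≡3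
                                    (≤-trans e∈cl[A] (≤-trans (R1 M A) ∣A∣≤2))))
      where
      ∣A∣≤2 : ∣ A ∣ ≤ 2
      ∣A∣≤2 = ≤-pred (≰⇒> 3≰∣A∣)
      ∣A∪e∣≡3 : ∣ A ∪ ⁅ e ⁆ ∣ ≡ 3
      ∣A∪e∣≡3 = trans (x∉p⇒∣p∪⁅x⁆∣≡1+∣p∣ A e∉A) (cong suc (≤-antisym ∣A∣≤2 k≤∣A∣))

  r[A]≤r[A-a] : ∀ {e A B a} → ContractSep 2 e A B → 3 ≤ ∣ A ∣ → a ∈cl B → r A ≤ r (A - a)
  r[A]≤r[A-a] {e} {A} {B} {a} s 3≤∣A∣ a∈clB = +-cancelʳ-≤ (r B) (r A) (r (A - a)) (begin
    r A + r B                            ≤⟨ r[A]+r[B]≤R+2 ⟩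
    R + 2                                ≤⟨ no-2-separation (A - a) ((B ∪ ⁅ e ⁆) ∪ ⁅ a ⁆)
                                              (∉p-y⇒∈q∪⁅y⁆ ∉A⇒∈B∪e) 2≤∣A-a∣ 2≤∣∁[A-a]∣ ⟩
    r (A - a) + r ((B ∪ ⁅ e ⁆) ∪ ⁅ a ⁆)  ≤⟨ +-monoʳ-≤ (r (A - a)) (r[Z∪a∪b]≤r[Z] e∈cl[B] a∈clB) ⟩
    r (A - a) + r B                      ∎)
    where
    open ≤-Reasoning
    open ContractSep s
    open ContractSepFacts s
    open VerticalSepFacts s using (r[A]+r[B]≤R+2)
    e∈cl[B] : e ∈cl B
    e∈cl[B] = VerticalSepFacts.e∈cl[A] (swap-sides s)
    2≤∣A-a∣ : 2 ≤ ∣ A - a ∣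
    2≤∣A-a∣ = ≤-pred (≤-trans 3≤∣A∣ (∣p∣≤1+∣p-x∣ A a))
    2≤∣∁[A-a]∣ : 2 ≤ ∣ ∁ (A - a) ∣
    2≤∣∁[A-a]∣ = ≤-trans k≤∣B∣ (p⊆q⇒∣p∣≤∣q∣ (⊆-trans B⊆∁A (p⊆q⇒∁p⊇∁q (p─q⊆p A ⁅ a ⁆))))

  move-into-B : ∀ {e A B z} → ContractSep 2 e A B → 3 ≤ ∣ A ∣ → z ∈ A → z ∈cl B →
                ContractSep 2 e (A - z) (B ∪ ⁅ z ⁆)
  move-into-B {e} {A} {B} {z} s 3≤∣A∣ z∈A z∈clB = record
    { e∉A      = λ e∈A-z → e∉A (p─q⊆p A ⁅ z ⁆ e∈A-z)
    ; e∉B      = x∉p∪q e∉B (x≢y⇒x∉⁅y⁆ λ e≡z → e∉A (subst (_∈ A) (sym e≡z) z∈A))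
    ; cover    = cover′
    ; disjoint = disjoint′
    ; k≤∣A∣    = ≤-pred (≤-trans 3≤∣A∣ (∣p∣≤1+∣p-x∣ A z))
    ; k≤∣B∣    = ≤-trans k≤∣B∣ (∣p∣≤∣p∪q∣ B ⁅ z ⁆)
    ; rank-sum = ≤-trans (+-mono-≤ (r-mono A-z∪e⊆A∪e) r[B∪z∪e]≤r[B∪e]) rank-sum
    }
    where
    open ContractSep s
    A-z∪e⊆A∪e : (A - z) ∪ ⁅ e ⁆ ⊆ A ∪ ⁅ e ⁆
    A-z∪e⊆A∪e = ∪-least (⊆-trans (p─q⊆p A ⁅ z ⁆) (p⊆p∪q ⁅ e ⁆)) (q⊆p∪q A ⁅ e ⁆)
    r[B∪z∪e]≤r[B∪e] : r ((B ∪ ⁅ z ⁆) ∪ ⁅ e ⁆) ≤ r (B ∪ ⁅ e ⁆)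
    r[B∪z∪e]≤r[B∪e] = ≤-trans (r[Z∪a∪b]≤r[Z] z∈clB (VerticalSepFacts.e∈cl[A] (swap-sides s)))
                              (r-mono (p⊆p∪q ⁅ e ⁆))
    cover′ : ∀ x → x ≢ e → x ∈ A - z ⊎ x ∈ B ∪ ⁅ z ⁆
    cover′ x x≢e with cover x x≢e
    ... | inj₂ x∈B = inj₂ (p⊆p∪q ⁅ z ⁆ x∈B)
    ... | inj₁ x∈A with x ≟F z
    ...   | yes refl = inj₂ (q⊆p∪q B ⁅ x ⁆ (x∈⁅x⁆ x))
    ...   | no x≢z   = inj₁ (x∈p∧x≢y⇒x∈p-y x∈A x≢z)
    disjoint′ : ∀ {x} → x ∈ A - z → x ∉ B ∪ ⁅ z ⁆
    disjoint′ x∈A-z = x∉p∪q (disjoint (p─q⊆p A ⁅ z ⁆ x∈A-z)) (x∈p─q⇒x∉q A ⁅ z ⁆ x∈A-z)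

module FourElementCocircuit {n : ℕ} (M : Matroid n) (3-connected : IsNConnected 3 M)
                            (C : Subset n) (C-cocircuit : IsCocircuit M C) (∣C∣≡4 : ∣ C ∣ ≡ 4) where

  open Rank M
  open ThreeConnected M 3-connected (subst (_≤ n) ∣C∣≡4 (∣p∣≤n C))
  open VerticalSepFacts

  R≤r[∁C∪e] : ∀ {e} → e ∈ C → R ≤ r (∁ C ∪ ⁅ e ⁆)
  R≤r[∁C∪e] {e} e∈C = ≤-trans
    (coindependent⇒R≤r[∁X] (C - e) 1≤∣C-e∣ (proj₂ C-cocircuit (C - e) (x∈p⇒p-x⊂p e∈C)))
    (r-mono (∁[p-x]⊆∁p∪⁅x⁆ C e))
    where
    1≤∣C-e∣ : 1 ≤ ∣ C - e ∣
    1≤∣C-e∣ = ≤-pred (≤-trans (s≤s (s≤s z≤n)) (subst (_≤ suc ∣ C - e ∣) ∣C∣≡4 (∣p∣≤1+∣p-x∣ C e)))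

  r[S]<r[S∪e] : ∀ {S e} → S ⊆ ∁ C → e ∈ C → r S < r (S ∪ ⁅ e ⁆)
  r[S]<r[S∪e] {S} {e} S⊆∁C e∈C = +-cancelʳ-≤ (r (∁ C)) (suc (r S)) (r (S ∪ ⁅ e ⁆)) (begin
    suc (r S) + r (∁ C)      ≡⟨ sym (+-suc (r S) (r (∁ C))) ⟩
    r S + suc (r (∁ C))      ≤⟨ +-monoʳ-≤ (r S) (≤-trans (codependent⇒r[∁X]<R C (proj₁ C-cocircuit))
                                                        (R≤r[∁C∪e] e∈C)) ⟩
    r S + r (∁ C ∪ ⁅ e ⁆)    ≡⟨ +-comm (r S) _ ⟩
    r (∁ C ∪ ⁅ e ⁆) + r S    ≤⟨ r-submodular (S ∪ ⁅ e ⁆) (∁ C) ∁C∪e⊆ S⊆ ⟩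
    r (S ∪ ⁅ e ⁆) + r (∁ C)  ∎)
    where
    open ≤-Reasoning
    ∁C∪e⊆ : ∁ C ∪ ⁅ e ⁆ ⊆ (S ∪ ⁅ e ⁆) ∪ ∁ C
    ∁C∪e⊆ = ∪-least (q⊆p∪q (S ∪ ⁅ e ⁆) (∁ C)) (⊆-trans (q⊆p∪q S ⁅ e ⁆) (p⊆p∪q (∁ C)))
    S⊆ : S ⊆ (S ∪ ⁅ e ⁆) ∩ ∁ C
    S⊆ x∈S = x∈p∩q⁺ (p⊆p∪q ⁅ e ⁆ x∈S , S⊆∁C x∈S)

  C-element-∉cl : ∀ {S e} → S ⊆ ∁ C → e ∈ C → ¬ e ∈cl S
  C-element-∉cl S⊆∁C e∈C = <⇒≱ (r[S]<r[S∪e] S⊆∁C e∈C)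

  circuit-meets-C-again : ∀ {T y} → IsCircuit r T → y ∈ T → y ∈ C → ∃ λ z → z ∈ T × z ∈ C × z ≢ y
  circuit-meets-C-again T-circuit y∈T y∈C with ∩≡⁅⁆-or-another y∈T y∈C
  ... | inj₂ another = another
  ... | inj₁ T∩C≡y   = ⊥-elim (C-element-∉cl (∩≡⁅a⁆⇒A-a⊆∁S T∩C≡y) y∈C (circuit⇒∈cl T-circuit y∈T))

  vertical-sep-meets-C : ∀ {e A B} → e ∈ C → ContractSep 2 e A B → ∃ λ x → x ∈ A × x ∈ C
  vertical-sep-meets-C {e} {A} e∈C s with any? (λ x → x ∈? A ×-dec x ∈? C)
  ... | yes found = found
  ... | no none   = ⊥-elim (C-element-∉cl A⊆∁C e∈C (e∈cl[A] s))
    where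
    A⊆∁C : A ⊆ ∁ C
    A⊆∁C {x} x∈A = x∉p⇒x∈∁p λ x∈C → none (x , x∈A , x∈C)

  -- C − e has three elements and both sides meet it, so one side meets it only once.
  some-side-meets-C-once : ∀ {e A B} → e ∈ C → ContractSep 2 e A B →
                           (∃ λ y → B ∩ C ≡⁅ y ⁆) ⊎ (∃ λ y → A ∩ C ≡⁅ y ⁆)
  some-side-meets-C-once {e} {A} {B} e∈C s
    with vertical-sep-meets-C e∈C s | vertical-sep-meets-C e∈C (swap-sides s)
  ... | a , a∈A , a∈C | b , b∈B , b∈C with ∩≡⁅⁆-or-another a∈A a∈C | ∩≡⁅⁆-or-another b∈B b∈C
  ...   | inj₁ A∩C≡a | _          = inj₂ (a , A∩C≡a)
  ...   | inj₂ _     | inj₁ B∩C≡b = inj₁ (b , B∩C≡b)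
  ...   | inj₂ (a′ , a′∈A , a′∈C , a′≢a) | inj₂ (b′ , b′∈B , b′∈C , b′≢b) =
    ⊥-elim (n≮n 4 (subst (5 ≤_) ∣C∣≡4 (5≤∣p∣ (≢-sym a′≢a) (B≢A b∈B a∈A) (B≢A b∈B a′∈A)
            (B≢A b′∈B a∈A) (B≢A b′∈B a′∈A) b′≢b
            (≢-sym (x∈p∧y∉p⇒x≢y a∈A e∉A)) (≢-sym (x∈p∧y∉p⇒x≢y a′∈A e∉A))
            (≢-sym (x∈p∧y∉p⇒x≢y b∈B e∉B)) (≢-sym (x∈p∧y∉p⇒x≢y b′∈B e∉B))
            a∈C a′∈C b∈C b′∈C e∈C)))
    where
    open ContractSep s
    B≢A : ∀ {x y} → x ∈ B → y ∈ A → x ≢ y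
    B≢A x∈B y∈A = x∈p∧y∉p⇒x≢y x∈B (disjoint y∈A)

  r[Y-y]<r[Y] : ∀ {e X Y y} → e ∈ C → ContractSep 2 e X Y → Y ∩ C ≡⁅ y ⁆ → r (Y - y) < r Y
  r[Y-y]<r[Y] {e} {X} {Y} {y} e∈C s Y∩C≡y = begin-strict
    r (Y - y)            <⟨ r[S]<r[S∪e] (∩≡⁅a⁆⇒A-a⊆∁S Y∩C≡y) e∈C ⟩
    r ((Y - y) ∪ ⁅ e ⁆)  ≤⟨ r-mono (∪-least (⊆-trans (p─q⊆p Y ⁅ y ⁆) (p⊆p∪q ⁅ e ⁆)) (q⊆p∪q Y ⁅ e ⁆)) ⟩
    r (Y ∪ ⁅ e ⁆)        ≤⟨ e∈cl[A] (swap-sides s) ⟩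
    r Y                  ∎
    where open ≤-Reasoning

  y∉cl[X] : ∀ {e X Y y} → e ∈ C → ¬ InTriangle M e → ContractSep 2 e X Y → Y ∩ C ≡⁅ y ⁆ → ¬ y ∈cl X
  y∉cl[X] e∈C e∉Δ s Y∩C≡y y∈clX =
    <⇒≱ (r[Y-y]<r[Y] e∈C s Y∩C≡y) (r[A]≤r[A-a] (swap-sides s) (3≤∣A∣ (swap-sides s) e∉Δ) y∈clX)

  module Crossing {e X Y y P Q} (e∈C : e ∈ C) (e∉Δ : ¬ InTriangle M e) (s₁ : ContractSep 2 e X Y)
                  (Y∩C≡y : Y ∩ C ≡⁅ y ⁆) (y∉Δ : ¬ InTriangle M y) (s₂ : ContractSep 2 y P Q)
                  (e∈P : e ∈ P) where

    module S₁ = ContractSep s₁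
    module S₂ = ContractSep s₂

    y∈Y : y ∈ Y
    y∈Y = proj₁ Y∩C≡y

    y∈C : y ∈ C
    y∈C = proj₁ (proj₂ Y∩C≡y)

    y∉X : y ∉ X
    y∉X y∈X = S₁.disjoint y∈X y∈Y

    ∈Q⇒≢e : ∀ {x} → x ∈ Q → x ≢ e
    ∈Q⇒≢e x∈Q = x∈p∧y∉p⇒x≢y x∈Q (S₂.disjoint e∈P)

    Q∩C⊆X : ∀ {x} → x ∈ Q → x ∈ C → x ∈ X
    Q∩C⊆X {x} x∈Q x∈C with S₁.cover x (∈Q⇒≢e x∈Q)
    ... | inj₁ x∈X = x∈X
    ... | inj₂ x∈Y = ⊥-elim (S₂.e∉B (subst (_∈ Q) (proj₂ (proj₂ Y∩C≡y) x∈Y x∈C) x∈Q))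

    single-crossing : ∀ {q} → q ∈ C → Q ∩ X ≡⁅ q ⁆ → ⊥
    single-crossing {q} q∈C (q∈Q , q∈X , only-q) =
      <⇒≱ r[X-q]<r[X] (r[A]≤r[A-a] s₁ (3≤∣A∣ s₁ e∉Δ) q∈cl[Y])
      where
      open ≤-Reasoning
      Q∩C≡q : Q ∩ C ≡⁅ q ⁆
      Q∩C≡q = q∈Q , q∈C , λ x∈Q x∈C → only-q x∈Q (Q∩C⊆X x∈Q x∈C)
      X-q⊆P : X - q ⊆ P
      X-q⊆P {x} x∈X-q with S₂.cover x (x∈p∧y∉p⇒x≢y (p─q⊆p X ⁅ q ⁆ x∈X-q) y∉X)
      ... | inj₁ x∈P = x∈P
      ... | inj₂ x∈Q = ⊥-elim (x∈p─q⇒x∉q X ⁅ q ⁆ x∈X-q (x≡y⇒x∈⁅y⁆ (only-q x∈Q (p─q⊆p X ⁅ q ⁆ x∈X-q))))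
      r[X-q]<r[X] : r (X - q) < r X
      r[X-q]<r[X] = begin-strict
        r (X - q)            <⟨ ≰⇒> (y∉cl[X] y∈C y∉Δ s₂ Q∩C≡q ∘ ∈cl-mono X-q⊆P) ⟩
        r ((X - q) ∪ ⁅ q ⁆)  ≤⟨ r-mono (∪-least (p─q⊆p X ⁅ q ⁆) (x∈p⇒⁅x⁆⊆p q∈X)) ⟩
        r X                  ∎
      Q⊆[Y-y]∪q : Q ⊆ (Y - y) ∪ ⁅ q ⁆
      Q⊆[Y-y]∪q {x} x∈Q with S₁.cover x (∈Q⇒≢e x∈Q)
      ... | inj₁ x∈X = q⊆p∪q (Y - y) ⁅ q ⁆ (x≡y⇒x∈⁅y⁆ (only-q x∈Q x∈X))
      ... | inj₂ x∈Y = p⊆p∪q ⁅ q ⁆ (x∈p∧x≢y⇒x∈p-y x∈Y (x∈p∧y∉p⇒x≢y x∈Q S₂.e∉B))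
      Y∪q⊆ : Y ∪ ⁅ q ⁆ ⊆ ((Y - y) ∪ ⁅ q ⁆) ∪ ⁅ y ⁆
      Y∪q⊆ = ∪-least
        (⊆-trans (p⊆[p-x]∪⁅x⁆ Y y) (∪-least (⊆-trans (p⊆p∪q ⁅ q ⁆) (p⊆p∪q ⁅ y ⁆)) (q⊆p∪q _ ⁅ y ⁆)))
        (⊆-trans (q⊆p∪q (Y - y) ⁅ q ⁆) (p⊆p∪q ⁅ y ⁆))
      q∈cl[Y] : q ∈cl Y
      q∈cl[Y] = begin
        r (Y ∪ ⁅ q ⁆)                  ≤⟨ r-mono Y∪q⊆ ⟩
        r (((Y - y) ∪ ⁅ q ⁆) ∪ ⁅ y ⁆)  ≤⟨ ∈cl-mono Q⊆[Y-y]∪q (e∈cl[A] (swap-sides s₂)) ⟩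
        r ((Y - y) ∪ ⁅ q ⁆)            ≤⟨ r[Z∪x]≤1+r[Z] (Y - y) q ⟩
        suc (r (Y - y))                ≤⟨ r[Y-y]<r[Y] e∈C s₁ Y∩C≡y ⟩
        r Y                            ∎

    module DoubleCrossing (2≤∣Q∩X∣ : 2 ≤ ∣ Q ∩ X ∣) where

      V : Subset n
      V = ((Q ∪ X) ∪ ⁅ y ⁆) ∪ ⁅ e ⁆

      U : Subset n
      U = (P ∪ ⁅ y ⁆) ∪ (Y ∪ ⁅ e ⁆)

      D : Subset n
      D = (P ∪ ⁅ y ⁆) ∩ (Y ∪ ⁅ e ⁆)

      ∉Q∩X⇒∈U : ∀ {x} → x ∉ Q ∩ X → x ∈ U
      ∉Q∩X⇒∈U {x} x∉Q∩X with x ∈? Q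
      ... | yes x∈Q = q⊆p∪q _ _ (ContractSepFacts.∉A⇒∈B∪e s₁ λ x∈X → x∉Q∩X (x∈p∩q⁺ (x∈Q , x∈X)))
      ... | no x∉Q  = p⊆p∪q _ (ContractSepFacts.∉A⇒∈B∪e (swap-sides s₂) x∉Q)

      R+2≤r[Q∩X]+r[U] : R + 2 ≤ r (Q ∩ X) + r U
      R+2≤r[Q∩X]+r[U] = no-2-separation (Q ∩ X) U ∉Q∩X⇒∈U 2≤∣Q∩X∣
        (≤-trans S₁.k≤∣B∣ (p⊆q⇒∣p∣≤∣q∣ λ x∈Y → x∉p⇒x∈∁p λ x∈Q∩X → S₁.disjoint (p∩q⊆q Q X x∈Q∩X) x∈Y))

      r[Q∪X]+r[D]≤R+2 : r (Q ∪ X) + r D ≤ R + 2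
      r[Q∪X]+r[D]≤R+2 = +-cancelʳ-≤ (R + 2) _ _ (begin
        (r (Q ∪ X) + r D) + (R + 2)            ≤⟨ +-monoʳ-≤ (r (Q ∪ X) + r D) R+2≤r[Q∩X]+r[U] ⟩
        (r (Q ∪ X) + r D) + (r (Q ∩ X) + r U)  ≡⟨ interchange (r (Q ∪ X)) (r D) (r (Q ∩ X)) (r U) ⟩
        (r (Q ∪ X) + r (Q ∩ X)) + (r D + r U)  ≡⟨ cong (r (Q ∪ X) + r (Q ∩ X) +_) (+-comm (r D) (r U)) ⟩
        (r (Q ∪ X) + r (Q ∩ X)) + (r U + r D)  ≤⟨ +-mono-≤ (R3 M Q X) r[U]+r[D]≤r[P]+r[Y] ⟩
        (r Q + r X) + (r P + r Y)              ≡⟨ interchange (r Q) (r X) (r P) (r Y) ⟩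
        (r Q + r P) + (r X + r Y)              ≡⟨ cong (_+ (r X + r Y)) (+-comm (r Q) (r P)) ⟩
        (r P + r Q) + (r X + r Y)              ≤⟨ +-mono-≤ (r[A]+r[B]≤R+2 s₂) (r[A]+r[B]≤R+2 s₁) ⟩
        (R + 2) + (R + 2)                      ∎)
        where
        open ≤-Reasoning
        r[U]+r[D]≤r[P]+r[Y] : r U + r D ≤ r P + r Y
        r[U]+r[D]≤r[P]+r[Y] = ≤-trans (R3 M (P ∪ ⁅ y ⁆) (Y ∪ ⁅ e ⁆))
                                      (+-mono-≤ (e∈cl[A] s₂) (e∈cl[A] (swap-sides s₁)))

      r[V]≤r[Q∪X] : r V ≤ r (Q ∪ X)
      r[V]≤r[Q∪X] = r[Z∪a∪b]≤r[Z] (∈cl-mono (p⊆p∪q X) (e∈cl[A] (swap-sides s₂)))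
                                  (∈cl-mono (q⊆p∪q Q X) (e∈cl[A] s₁))

      Q∪X⊆V : Q ∪ X ⊆ V
      Q∪X⊆V = ⊆-trans (p⊆p∪q ⁅ y ⁆) (p⊆p∪q ⁅ e ⁆)

      y∈V : y ∈ V
      y∈V = p⊆p∪q ⁅ e ⁆ (q⊆p∪q (Q ∪ X) ⁅ y ⁆ (x∈⁅x⁆ y))

      e∈V : e ∈ V
      e∈V = q⊆p∪q _ ⁅ e ⁆ (x∈⁅x⁆ e)

      ∁V⊆Y : ∁ V ⊆ Y
      ∁V⊆Y {x} x∈∁V with S₁.cover x (x∈p∧y∉p⇒x≢y x∈∁V (x∈p⇒x∉∁p e∈V))
      ... | inj₁ x∈X = ⊥-elim (x∈∁p⇒x∉p x∈∁V (Q∪X⊆V (q⊆p∪q Q X x∈X)))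
      ... | inj₂ x∈Y = x∈Y

      ∁V⊆P : ∁ V ⊆ P
      ∁V⊆P {x} x∈∁V with S₂.cover x (x∈p∧y∉p⇒x≢y x∈∁V (x∈p⇒x∉∁p y∈V))
      ... | inj₁ x∈P = x∈P
      ... | inj₂ x∈Q = ⊥-elim (x∈∁p⇒x∉p x∈∁V (Q∪X⊆V (p⊆p∪q X x∈Q)))

      ∁V⊆∁C : ∁ V ⊆ ∁ C
      ∁V⊆∁C {x} x∈∁V = x∉p⇒x∈∁p λ x∈C →
        x∈∁p⇒x∉p x∈∁V (subst (_∈ V) (sym (proj₂ (proj₂ Y∩C≡y) (∁V⊆Y x∈∁V) x∈C)) y∈V)

      ∁V∪e⊆D : ∁ V ∪ ⁅ e ⁆ ⊆ D
      ∁V∪e⊆D = ∪-least (λ x∈∁V → x∈p∩q⁺ (p⊆p∪q ⁅ y ⁆ (∁V⊆P x∈∁V) , p⊆p∪q ⁅ e ⁆ (∁V⊆Y x∈∁V)))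
                       (x∈p⇒⁅x⁆⊆p (x∈p∩q⁺ (p⊆p∪q ⁅ y ⁆ e∈P , q⊆p∪q Y ⁅ e ⁆ (x∈⁅x⁆ e))))

      r[∁V]<r[D] : r (∁ V) < r D
      r[∁V]<r[D] = <-≤-trans (r[S]<r[S∪e] ∁V⊆∁C e∈C) (r-mono ∁V∪e⊆D)

      2≤∣∁∁V∣ : 2 ≤ ∣ ∁ (∁ V) ∣
      2≤∣∁∁V∣ = ≤-trans S₁.k≤∣A∣ (p⊆q⇒∣p∣≤∣q∣ λ x∈X → x∉p⇒x∈∁p (x∈p⇒x∉∁p (Q∪X⊆V (q⊆p∪q Q X x∈X))))

      -- With two elements, ∁V would give a 2-separation; with one element x, the
      -- rank bound forces r(D) ≤ 2, making {e, x, y} ⊆ D a triangle through e.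
      ∁V-empty : ∀ {x} → x ∉ ∁ V
      ∁V-empty {x} x∈∁V with 2 ≤? ∣ ∁ V ∣
      ... | yes 2≤∣∁V∣ = <⇒≱ (+-monoˡ-< (r (Q ∪ X)) r[∁V]<r[D]) (begin
        r D + r (Q ∪ X)      ≡⟨ +-comm (r D) _ ⟩
        r (Q ∪ X) + r D      ≤⟨ r[Q∪X]+r[D]≤R+2 ⟩
        R + 2                ≤⟨ no-2-separation (∁ V) V x∉∁p⇒x∈p 2≤∣∁V∣ 2≤∣∁∁V∣ ⟩
        r (∁ V) + r V        ≤⟨ +-monoʳ-≤ (r (∁ V)) r[V]≤r[Q∪X] ⟩
        r (∁ V) + r (Q ∪ X)  ∎)
        where open ≤-Reasoning
      ... | no 2≰∣∁V∣ = e∉Δ (r≤2⇒InTriangle e∈triple (∣triple∣≡3 e≢x y≢e y≢x)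
                               (≤-trans (r-mono (triple⊆ e∈D x∈D y∈D)) r[D]≤2))
        where
        open ≤-Reasoning
        e≢x : e ≢ x
        e≢x = x∈p∧y∉p⇒x≢y e∈V (x∈∁p⇒x∉p x∈∁V)
        y≢e : y ≢ e
        y≢e = x∈p∧y∉p⇒x≢y y∈Y S₁.e∉B
        y≢x : y ≢ x
        y≢x = x∈p∧y∉p⇒x≢y y∈V (x∈∁p⇒x∉p x∈∁V)
        e∈triple : e ∈ triple e x y
        e∈triple = p⊆p∪q ⁅ y ⁆ (p⊆p∪q ⁅ x ⁆ (x∈⁅x⁆ e))
        e∈D : e ∈ D
        e∈D = ∁V∪e⊆D (q⊆p∪q (∁ V) ⁅ e ⁆ (x∈⁅x⁆ e))
        x∈D : x ∈ D
        x∈D = ∁V∪e⊆D (p⊆p∪q ⁅ e ⁆ x∈∁V)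
        y∈D : y ∈ D
        y∈D = x∈p∩q⁺ (q⊆p∪q P ⁅ y ⁆ (x∈⁅x⁆ y) , p⊆p∪q ⁅ e ⁆ y∈Y)
        r[∁V]≤1 : r (∁ V) ≤ 1
        r[∁V]≤1 = ≤-trans (R1 M (∁ V)) (≤-pred (≰⇒> 2≰∣∁V∣))
        r[D]≤2 : r D ≤ 2
        r[D]≤2 = +-cancelˡ-≤ (R + 1) (r D) 2 (begin
          (R + 1) + r D          ≤⟨ +-monoˡ-≤ (r D) (no-1-separation (∁ V) V x∉∁p⇒x∈p (1≤∣p∣ x∈∁V)
                                                       (≤-trans (s≤s z≤n) 2≤∣∁∁V∣)) ⟩
          (r (∁ V) + r V) + r D  ≤⟨ +-monoˡ-≤ (r D) (+-mono-≤ r[∁V]≤1 r[V]≤r[Q∪X]) ⟩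
          (1 + r (Q ∪ X)) + r D  ≡⟨ +-assoc 1 (r (Q ∪ X)) (r D) ⟩
          1 + (r (Q ∪ X) + r D)  ≤⟨ +-monoʳ-≤ 1 r[Q∪X]+r[D]≤R+2 ⟩
          1 + (R + 2)            ≡⟨ trans (sym (+-suc R 2)) (sym (+-assoc R 1 2)) ⟩
          (R + 1) + 2            ∎)

      P⊆X∪e : P ⊆ X ∪ ⁅ e ⁆
      P⊆X∪e {x} x∈P with x ≟F e
      ... | yes refl = q⊆p∪q X ⁅ x ⁆ (x∈⁅x⁆ x)
      ... | no x≢e with S₁.cover x x≢e
      ...   | inj₁ x∈X = p⊆p∪q ⁅ e ⁆ x∈X
      ...   | inj₂ x∈Y = ⊥-elim (∁V-empty (x∉p⇒x∈∁p x∉V))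
        where
        x∉V : x ∉ V
        x∉V = x∉p∪q (x∉p∪q (x∉p∪q (S₂.disjoint x∈P) λ x∈X → S₁.disjoint x∈X x∈Y)
                           (x≢y⇒x∉⁅y⁆ (x∈p∧y∉p⇒x≢y x∈P S₂.e∉A)))
                    (x≢y⇒x∉⁅y⁆ x≢e)

    crossing-impossible : ⊥
    crossing-impossible with vertical-sep-meets-C y∈C (swap-sides s₂)
    ... | q , q∈Q , q∈C with ∩≡⁅⁆-or-another q∈Q (Q∩C⊆X q∈Q q∈C)
    ...   | inj₁ Q∩X≡q = single-crossing q∈C Q∩X≡q
    ...   | inj₂ (q′ , q′∈Q , q′∈X , q′≢q) =
      y∉cl[X] e∈C e∉Δ s₁ Y∩C≡y (∈cl-trans (e∈cl[A] s₁) (∈cl-mono P⊆X∪e (e∈cl[A] s₂)))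
      where
      open DoubleCrossing (2≤∣p∣ q′≢q (x∈p∩q⁺ (q′∈Q , q′∈X)) (x∈p∩q⁺ (q∈Q , Q∩C⊆X q∈Q q∈C)))

  no-vsep-at-sole-element : ∀ {e X Y y P Q} → e ∈ C → ¬ InTriangle M e → ContractSep 2 e X Y →
                            Y ∩ C ≡⁅ y ⁆ → ¬ InTriangle M y → ¬ ContractSep 2 y P Q
  no-vsep-at-sole-element e∈C e∉Δ s₁ Y∩C≡y y∉Δ s₂
    with ContractSep.cover s₂ _ (≢-sym (x∈p∧y∉p⇒x≢y (proj₁ Y∩C≡y) (ContractSep.e∉B s₁)))
  ... | inj₁ e∈P = Crossing.crossing-impossible e∈C e∉Δ s₁ Y∩C≡y y∉Δ s₂ e∈P
  ... | inj₂ e∈Q = Crossing.crossing-impossible e∈C e∉Δ s₁ Y∩C≡y y∉Δ (swap-sides s₂) e∈Q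

  -- The triangle through y meets C again in some z ∈ X, and its third element lies in Y
  -- (else y ∈ cl X).  Moving z to Y leaves X − z meeting C only in f.
  no-vsep-at-other-element : ∀ {e X Y y f P Q} → e ∈ C → ¬ InTriangle M e → ContractSep 2 e X Y →
                             Y ∩ C ≡⁅ y ⁆ → InTriangle M y → f ∈ C → ¬ InTriangle M f → f ≢ e → f ≢ y →
                             ¬ ContractSep 2 f P Q
  no-vsep-at-other-element {e} {X} {Y} {y} {f} e∈C e∉Δ s Y∩C≡y (T , (T-circuit , ∣T∣≡3) , y∈T)
                           f∈C f∉Δ f≢e f≢y s-f
    with circuit-meets-C-again T-circuit y∈T (proj₁ (proj₂ Y∩C≡y))
       | any? (λ t → t ∈? T ×-dec ¬? (t ≟F y) ×-dec ¬? (t ∈? X))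
  ... | _ | no T-y⊆X = y∉cl[X] e∈C e∉Δ s Y∩C≡y (∈cl-mono T-y⊆X′ (circuit⇒∈cl T-circuit y∈T))
    where
    T-y⊆X′ : T - y ⊆ X
    T-y⊆X′ {x} x∈T-y = decidable-stable (x ∈? X) λ x∉X →
      T-y⊆X (x , p─q⊆p T ⁅ y ⁆ x∈T-y , x∉⁅y⁆⇒x≢y (x∈p─q⇒x∉q T ⁅ y ⁆ x∈T-y) , x∉X)
  ... | z , z∈T , z∈C , z≢y | yes (t , t∈T , t≢y , t∉X) =
    no-vsep-at-sole-element e∈C e∉Δ (swap-sides (move-into-B s (3≤∣A∣ s e∉Δ) z∈X z∈cl[Y])) X-z∩C≡f f∉Δ s-f
    where
    open ContractSep s
    only-y : ∀ {x} → x ∈ Y → x ∈ C → x ≡ y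
    only-y = proj₂ (proj₂ Y∩C≡y)
    ∉Δ⇒∉T : ∀ {x} → ¬ InTriangle M x → x ∉ T
    ∉Δ⇒∉T x∉Δ x∈T = x∉Δ (T , (T-circuit , ∣T∣≡3) , x∈T)
    z∈X : z ∈ X
    z∈X with cover z (x∈p∧y∉p⇒x≢y z∈T (∉Δ⇒∉T e∉Δ))
    ... | inj₁ z∈X = z∈X
    ... | inj₂ z∈Y = ⊥-elim (z≢y (only-y z∈Y z∈C))
    t∈Y : t ∈ Y
    t∈Y with cover t (x∈p∧y∉p⇒x≢y t∈T (∉Δ⇒∉T e∉Δ))
    ... | inj₁ t∈X = ⊥-elim (t∉X t∈X)
    ... | inj₂ t∈Y = t∈Y
    t≢z : t ≢ z
    t≢z = ≢-sym (x∈p∧y∉p⇒x≢y z∈X t∉X)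
    T-z⊆Y : T - z ⊆ Y
    T-z⊆Y {x} x∈T-z with x ≟F y | x ≟F t
    ... | yes refl | _        = proj₁ Y∩C≡y
    ... | no _     | yes refl = t∈Y
    ... | no x≢y   | no x≢t   = ⊥-elim (n≮n 3 (subst (4 ≤_) ∣T∣≡3
      (4≤∣p∣ (≢-sym z≢y) t≢y t≢z x≢y (x∉⁅y⁆⇒x≢y (x∈p─q⇒x∉q T ⁅ z ⁆ x∈T-z)) x≢t
             y∈T z∈T t∈T (p─q⊆p T ⁅ z ⁆ x∈T-z))))
    z∈cl[Y] : z ∈cl Y
    z∈cl[Y] = ∈cl-mono T-z⊆Y (circuit⇒∈cl T-circuit z∈T)
    f∈X : f ∈ X
    f∈X with cover f f≢e
    ... | inj₁ f∈X = f∈X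
    ... | inj₂ f∈Y = ⊥-elim (f≢y (only-y f∈Y f∈C))
    X-z∩C≡f : (X - z) ∩ C ≡⁅ f ⁆
    X-z∩C≡f = x∈p∧x≢y⇒x∈p-y f∈X (x∈p∧y∉p⇒x≢y z∈T (∉Δ⇒∉T f∉Δ) ∘ sym) , f∈C , only-f
      where
      only-f : ∀ {x} → x ∈ X - z → x ∈ C → x ≡ f
      only-f {x} x∈X-z x∈C = decidable-stable (x ≟F f) λ x≢f → n≮n 4 (subst (5 ≤_) ∣C∣≡4
        (5≤∣p∣ (≢-sym (x∈p∧y∉p⇒x≢y (proj₁ Y∩C≡y) e∉B)) (x∈p∧y∉p⇒x≢y z∈T (∉Δ⇒∉T e∉Δ)) z≢y f≢e f≢y
               (≢-sym (x∈p∧y∉p⇒x≢y z∈T (∉Δ⇒∉T f∉Δ)))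
               (x∈p∧y∉p⇒x≢y x∈X e∉A) (x∈p∧y∉p⇒x≢y x∈X λ y∈X → disjoint y∈X (proj₁ Y∩C≡y))
               (x∉⁅y⁆⇒x≢y (x∈p─q⇒x∉q X ⁅ z ⁆ x∈X-z)) x≢f
               e∈C (proj₁ (proj₂ Y∩C≡y)) z∈C f∈C x∈C))
        where
        x∈X : x ∈ X
        x∈X = p─q⊆p X ⁅ z ⁆ x∈X-z

  via-sole-element : ∀ {c′ c″ X Y y} → c′ ∈ C → c″ ∈ C → c″ ≢ c′ →
                     ¬ InTriangle M c′ → ¬ InTriangle M c″ → ContractSep 2 c′ X Y → Y ∩ C ≡⁅ y ⁆ →
                     ∃ λ c → c ∈ C × ContractionIsNConnected 3 M c
  via-sole-element {c″ = c″} {y = y} c′∈C c″∈C c″≢c′ c′∉Δ c″∉Δ s Y∩C≡y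
    with contraction-3-connected-or-vertical-sep y | contraction-3-connected-or-vertical-sep c″
  ... | inj₁ M/y | _         = y , proj₁ (proj₂ Y∩C≡y) , M/y
  ... | inj₂ _   | inj₁ M/c″ = c″ , c″∈C , M/c″
  ... | inj₂ (_ , _ , s-y) | inj₂ (_ , _ , s-c″) = ⊥-elim (no-vsep-at-sole-element c′∈C c′∉Δ s Y∩C≡y y∉Δ s-y)
    where
    y∉Δ : ¬ InTriangle M y
    y∉Δ y∈Δ with y ≟F c″
    ... | yes refl = c″∉Δ y∈Δ
    ... | no y≢c″  = no-vsep-at-other-element c′∈C c′∉Δ s Y∩C≡y y∈Δ c″∈C c″∉Δ c″≢c′ (≢-sym y≢c″) s-c″

  some-contraction-3-connected : ∀ {c′ c″} → c′ ≢ c″ → c′ ∈ C → c″ ∈ C →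
                                 ¬ InTriangle M c′ → ¬ InTriangle M c″ →
                                 ∃ λ c → c ∈ C × ContractionIsNConnected 3 M c
  some-contraction-3-connected {c′} c′≢c″ c′∈C c″∈C c′∉Δ c″∉Δ with contraction-3-connected-or-vertical-sep c′
  ... | inj₁ M/c′ = c′ , c′∈C , M/c′
  ... | inj₂ (_ , _ , s) with some-side-meets-C-once c′∈C s
  ...   | inj₁ (_ , Y∩C≡y) = via-sole-element c′∈C c″∈C (≢-sym c′≢c″) c′∉Δ c″∉Δ s Y∩C≡y
  ...   | inj₂ (_ , X∩C≡y) = via-sole-element c′∈C c″∈C (≢-sym c′≢c″) c′∉Δ c″∉Δ (swap-sides s) X∩C≡y

lemma4p5 : ∀ {n} (M : Matroid n) → IsNConnected 3 M → (C : Subset n) → IsCocircuit M C → ∣ C ∣ ≡ 4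
    → (∃₂ λ c′ c″ → c′ ≢ c″ × c′ ∈ C × c″ ∈ C × ¬ InTriangle M c′ × ¬ InTriangle M c″)
    → ∃ λ c → c ∈ C × ContractionIsNConnected 3 M c
lemma4p5 M 3-connected C C-cocircuit ∣C∣≡4 (_ , _ , c′≢c″ , c′∈C , c″∈C , c′∉Δ , c″∉Δ) =
  some-contraction-3-connected c′≢c″ c′∈C c″∈C c′∉Δ c″∉Δ
  where open FourElementCocircuit M 3-connected C C-cocircuit ∣C∣≡4
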